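{- Let $k\ge1$, let $G=(V,E)$ be a finite $(k+1)$-claw free graph with positive vertex weights $w$, let $O$ be a maximum-weight independent set and $A$ an independent set of $G$ with $N(o,A)\neq\emptyset$ for all $o\in O$. Suppose $A$ is locally optimal with respect to 2-exchanges and let $0\le\delta\le\epsilon\le1/2$. For $0\le t\le k$ define $\rho_t=\frac{t(\epsilon-\delta)}{1-\delta}-\frac{\epsilon-\delta}{1-\epsilon}$. Then for any isolated edge $(a,b)$ of $H_\epsilon$, $$\sum_{v\in\{a,b\}}\left[\frac{\Delta_v}{w_v}+\frac{\Psi_v}{w_v}\right]\ge\left(\Big(1-\frac{\epsilon-\delta}{1-\epsilon}\Big)-k\delta\right)w_a+\big(\rho_{|C_b|}-|C_b|\delta\big)w_b+\sum_{v\in\{a,b\}}\sum_{o\in C_v}\delta\, w(N(o,A)).$$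
   Context: $(k+1)$-claw free: no induced subgraph consisting of a vertex adjacent to $k+1$ pairwise non-adjacent vertices. $w(X)=\sum_{v\in X}w_v$, $w^2(X)=\sum_{v\in X}w_v^2$. For $X,Y\subseteq V$, $N(X,Y)=\{y\in Y: y\text{ adjacent to some }x\in X\}\cup(X\cap Y)$, $N(v,Y)=N(\{v\},Y)$, $A-a=A\setminus\{a\}$. For $o\in O$, $\pi(o)$ is a vertex of $N(o,A)$ of maximum weight (ties broken arbitrarily but consistently). For $a\in A$: $C_a=\{o\in O:\pi(o)=a\}$, $N^+_a=\{a\}\cup\bigcup_{o\in C_a}N(o,A-a)$, $\psi_{a,o}=(w_o-w_a)^2+w_a\,w(N(o,A-a))-w^2(N(o,A-a))$, $\Psi_a=\sum_{o\in C_a}\psi_{a,o}$, $\Delta_a=w^2(N^+_a)-w^2(C_a)$. $A$ is locally optimal under $s$-exchanges (here $s=2$) if for every $X\subseteq A$ with $1\le|X|\le s$, $w^2(\bigcup_{x\in X}C_x)\le w^2(\bigcup_{x\in X}N^+_x)$. The exchange graph $H_\epsilon$ ($0\le\epsilon\le1$) is the directed graph with vertex set $A$ having an arc $(a,b)$, $a\neq b$, iff $a\in N^+_b$ and $w_a\ge(1-\epsilon)w_b$. An isolated edge $(a,b)$ of $H_\epsilon$ is an arc $(a,b)$ of $H_\epsilon$ such that neither $a$ nor $b$ is incident to any other arc of $H_\epsilon$.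
   Formalization: The vertex weights w and the parameters δ and ε are rational. -}

module Defs where

open import Data.Bool using (Bool; true; false; if_then_else_; _∧_; _∨_; not; T)
open import Data.Nat as ℕ using (ℕ; zero; suc)
open import Data.Fin using (Fin; zero; suc)
open import Data.Fin.Properties using () renaming (_≟_ to _≟ᶠ_)
open import Data.Integer using (+_)
open import Data.Rational using (ℚ; 0ℚ; 1ℚ; _+_; _*_; _-_; _÷_; _≤_; _<_; _/_; ≢-nonZero)
open import Data.Rational.Properties using (_≟_)
open import Data.Product using (Σ; _×_; _,_; ∃)
open import Data.Sum using (_⊎_)
open import Relation.Nullary using (¬_; yes; no; does)
open import Relation.Binary.PropositionalEquality using (_≡_; _≢_)

VSet : ℕ → Set
VSet n = Fin n → Bool

_∈_ : ∀ {n} → Fin n → VSet n → Set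
v ∈ X = T (X v)

ΣFin : ∀ {n} → (Fin n → ℚ) → ℚ
ΣFin {zero}  f = 0ℚ
ΣFin {suc n} f = f zero + ΣFin (λ i → f (suc i))

Σ∈ : ∀ {n} → VSet n → (Fin n → ℚ) → ℚ
Σ∈ X f = ΣFin (λ v → if X v then f v else 0ℚ)

card : ∀ {n} → VSet n → ℕ
card {zero}  X = zero
card {suc n} X = (if X zero then 1 else 0) ℕ.+ card (λ i → X (suc i))

anyFin : ∀ {n} → (Fin n → Bool) → Bool
anyFin {zero}  f = false
anyFin {suc n} f = f zero ∨ anyFin (λ i → f (suc i))

_∪_ : ∀ {n} → VSet n → VSet n → VSet n
(X ∪ Y) v = X v ∨ Y v

_∩_ : ∀ {n} → VSet n → VSet n → VSet n
(X ∩ Y) v = X v ∧ Y v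

_⊆_ : ∀ {n} → VSet n → VSet n → Set
X ⊆ Y = ∀ v → v ∈ X → v ∈ Y

｛_｝ : ∀ {n} → Fin n → VSet n
｛ a ｝ v = does (v ≟ᶠ a)

_－_ : ∀ {n} → VSet n → Fin n → VSet n
(A － a) v = A v ∧ not (does (v ≟ᶠ a))

⋃ : ∀ {n} → VSet n → (Fin n → VSet n) → VSet n
⋃ X F v = anyFin (λ x → X x ∧ F x v)

record Graph (n : ℕ) : Set where
  field
    adj     : Fin n → Fin n → Bool
    symm    : ∀ u v → adj u v ≡ adj v u
    irrefl  : ∀ v → adj v v ≡ false

open Graph public

Independent : ∀ {n} → Graph n → VSet n → Set
Independent G X = ∀ u v → u ∈ X → v ∈ X → adj G u v ≡ false

-- ClawFree m G : G has no m-claw, i.e. no centre c adjacent to m distinct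
-- pairwise non-adjacent vertices.  "(k+1)-claw free" is ClawFree (suc k) G.
ClawFree : ∀ {n} → ℕ → Graph n → Set
ClawFree {n} m G =
  ¬ (Σ (Fin n) λ c → Σ (Fin m → Fin n) λ f →
       (∀ i j → i ≢ j → f i ≢ f j)
     × (∀ i j → i ≢ j → adj G (f i) (f j) ≡ false)
     × (∀ i → adj G c (f i) ≡ true))

Weight : ℕ → Set
Weight n = Fin n → ℚ

w[_] : ∀ {n} → Weight n → VSet n → ℚ
w[ w ] X = Σ∈ X w

w²[_] : ∀ {n} → Weight n → VSet n → ℚ
w²[ w ] X = Σ∈ X (λ v → w v * w v)

MaxWeightIndependent : ∀ {n} → Graph n → Weight n → VSet n → Set
MaxWeightIndependent G w O =
  Independent G O × (∀ I → Independent G I → w[ w ] I ≤ w[ w ] O)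

NS : ∀ {n} → Graph n → VSet n → VSet n → VSet n
NS G X Y y = (Y y ∧ anyFin (λ x → X x ∧ adj G x y)) ∨ (X y ∧ Y y)

Nv : ∀ {n} → Graph n → Fin n → VSet n → VSet n
Nv G v Y = NS G ｛ v ｝ Y

-- Total division; only ever applied with nonzero denominators here
-- (for q = 0 it returns 0, a value that is never used in the statement).

_/ℚ_ : ℚ → ℚ → ℚ
p /ℚ q with q ≟ 0ℚ
... | yes _  = 0ℚ
... | no q≢0 = _÷_ p q {{≢-nonZero q≢0}}

ℕ→ℚ : ℕ → ℚ
ℕ→ℚ m = (+ m) / 1

module Setup {n : ℕ} (G : Graph n) (w : Weight n) (O A : VSet n)
             (π : Fin n → Fin n) where

  C : Fin n → VSet n
  C a o = O o ∧ does (π o ≟ᶠ a)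

  N⁺ : Fin n → VSet n
  N⁺ a = ｛ a ｝ ∪ ⋃ (C a) (λ o → Nv G o (A － a))

  ψ : Fin n → Fin n → ℚ
  ψ a o = (w o - w a) * (w o - w a)
          + w a * w[ w ] (Nv G o (A － a)) - w²[ w ] (Nv G o (A － a))

  Ψ : Fin n → ℚ
  Ψ a = Σ∈ (C a) (ψ a)

  Δ : Fin n → ℚ
  Δ a = w²[ w ] (N⁺ a) - w²[ w ] (C a)

  LocallyOptimal : ℕ → Set
  LocallyOptimal s = ∀ (X : VSet n) → X ⊆ A → 1 ℕ.≤ card X → card X ℕ.≤ s →
    w²[ w ] (⋃ X C) ≤ w²[ w ] (⋃ X N⁺)

  -- arcs of the exchange graph H_ε (vertex set A)
  Arc : ℚ → Fin n → Fin n → Set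
  Arc ε a b = a ∈ A × b ∈ A × a ≢ b × a ∈ N⁺ b × ((1ℚ - ε) * w b ≤ w a)

  IsolatedEdge : ℚ → Fin n → Fin n → Set
  IsolatedEdge ε a b = Arc ε a b ×
    (∀ x y → Arc ε x y → (x ≡ a ⊎ x ≡ b ⊎ y ≡ a ⊎ y ≡ b) → (x ≡ a × y ≡ b))

{-# OPTIONS --safe #-}

-- Write x = w_a ≤ y = w_b: a ∈ N(o₀, A - b) for some o₀ ∈ C_b, and π o₀ = b is a heaviest
-- vertex of N(o₀, A).  Isolation of (a,b) in H_ε means that every u ≠ a in N = N(o, A - c),
-- o ∈ C_c, c ∈ {a, b}, is light: w_u < (1 - ε) w_c.  Hence w_c w(N) - w²(N) ≥ δ w_c w(N),
-- which bounds Ψ_a; for Ψ_b the light neighbours leave an extra q w²(N), where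
-- q = (ε - δ)/(1 - ε), and (t - y)² + q t² ≥ q y² / (1 + q) supplies the ρ-term.  Local
-- optimality for {a}, {b} and {a, b} gives Δ_a, Δ_b ≥ 0 and Δ_a + Δ_b ≥ x², because
-- a ∈ N⁺_a ∩ N⁺_b.  The elements of C_a, and the o ∈ C_b with a ∈ N(o, A - b), are pairwise
-- non-adjacent O-neighbours of a, so claw-freeness allows at most k of them.  After
-- multiplying by x y the claimed inequality is a nonnegative combination of these facts.

module Submission where

open import Defs
open import Data.Nat as ℕ using (ℕ; suc)
open import Data.Fin using (Fin)
open import Data.Product using (Σ; _×_; _,_)
open import Data.Rational using (ℚ; 0ℚ; 1ℚ; _+_; _*_; _-_; _≤_; _<_; _/_)
open import Data.Integer using (+_)

open import Algebra.Bundles using (CommutativeMonoid; Ring)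
import Algebra.Properties.Semiring.Sum as SemiringSum
open import Data.Bool using (Bool; true; false; if_then_else_; _∧_; _∨_; not; T)
open import Data.Bool.Properties
  using (T-∧; T-∨; T-≡; ∧-zeroʳ; ∧-identityʳ; ∨-identityʳ; ∧-distribʳ-∨; ∨-commutativeMonoid)
open import Algebra.Properties.CommutativeSemigroup
  (CommutativeMonoid.commutativeSemigroup ∨-commutativeMonoid)
  using () renaming (interchange to ∨-interchange)
open import Data.Empty using (⊥; ⊥-elim)
open import Data.Fin using (zero; suc; inject≤)
open import Data.Fin.Properties using (suc-injective; inject≤-injective) renaming (_≟_ to _≟ᶠ_)
import Data.Integer as ℤ
import Data.Integer.Properties as ℤₚ
open import Data.Nat using (zero)
open import Data.Nat.Coprimality using (1-coprimeTo; sym)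
import Data.Nat.Properties as ℕ
open import Data.Product using (proj₁; proj₂; ∃-syntax)
open import Data.Rational using (-_; 1/_; mkℚ; positive; nonNegative; ≢-nonZero)
import Data.Rational.Properties as ℚ
open import Data.Rational.Solver using (module +-*-Solver)
open import Data.Sum using (_⊎_; inj₁; inj₂)
open import Data.Unit using (tt)
open import Function using (_∘_; Equivalence)
open import Relation.Nullary using (¬_; does; yes; no)
open import Relation.Nullary.Decidable using (toWitness)
open import Relation.Binary.PropositionalEquality
  using (_≡_; _≢_; refl; cong; cong₂; subst; subst₂; trans; module ≡-Reasoning)
  renaming (sym to ≡-sym)

open +-*-Solver

p≤q⇒0≤q-p : ∀ {p q} → p ≤ q → 0ℚ ≤ q - p
p≤q⇒0≤q-p {p} {q} p≤q = subst (_≤ q - p) (ℚ.+-inverseʳ p) (ℚ.+-monoˡ-≤ (- p) p≤q)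

0≤q-p⇒p≤q : ∀ {p q} → 0ℚ ≤ q - p → p ≤ q
0≤q-p⇒p≤q {p} {q} 0≤q-p = subst₂ _≤_ (ℚ.+-identityʳ p) p+[q-p]≡q (ℚ.+-monoʳ-≤ p 0≤q-p)
  where
  p+[q-p]≡q : p + (q - p) ≡ q
  p+[q-p]≡q = solve 2 (λ p q → p :+ (q :- p) := q) refl p q

+-nonNeg : ∀ {p q} → 0ℚ ≤ p → 0ℚ ≤ q → 0ℚ ≤ p + q
+-nonNeg = ℚ.+-mono-≤

*-nonNeg : ∀ {p q} → 0ℚ ≤ p → 0ℚ ≤ q → 0ℚ ≤ p * q
*-nonNeg {p} {q} 0≤p 0≤q =
  subst (_≤ p * q) (ℚ.*-zeroʳ p) (ℚ.*-monoˡ-≤-nonNeg p {{nonNegative 0≤p}} 0≤q)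

square-nonNeg : ∀ p → 0ℚ ≤ p * p
square-nonNeg p with ℚ.≤-total 0ℚ p
... | inj₁ 0≤p = *-nonNeg 0≤p 0≤p
... | inj₂ p≤0 = subst (0ℚ ≤_) [-p][-p]≡pp (*-nonNeg 0≤-p 0≤-p)
  where
  0≤-p : 0ℚ ≤ - p
  0≤-p = ℚ.neg-antimono-≤ p≤0
  [-p][-p]≡pp : (- p) * (- p) ≡ p * p
  [-p][-p]≡pp = solve 1 (λ p → (:- p) :* (:- p) := p :* p) refl p

*-/ℚ : ∀ p {d} → 0ℚ < d → d * (p /ℚ d) ≡ p
*-/ℚ p {d} 0<d with d ℚ.≟ 0ℚ
... | yes d≡0 = ⊥-elim (ℚ.<-irrefl (≡-sym d≡0) 0<d)
... | no d≢0 = begin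
  d * (p * 1/ d)  ≡⟨ solve 3 (λ d p e → d :* (p :* e) := (d :* e) :* p) refl d p (1/ d) ⟩
  (d * 1/ d) * p  ≡⟨ cong (_* p) (ℚ.*-inverseʳ d) ⟩
  1ℚ * p          ≡⟨ ℚ.*-identityˡ p ⟩
  p               ∎
  where
  open ≡-Reasoning
  instance _ = ≢-nonZero d≢0

/ℚ-nonNeg : ∀ {p d} → 0ℚ ≤ p → 0ℚ < d → 0ℚ ≤ p /ℚ d
/ℚ-nonNeg {p} {d} 0≤p 0<d with d ℚ.≟ 0ℚ
... | yes _ = ℚ.≤-refl
... | no d≢0 = *-nonNeg 0≤p (ℚ.<⇒≤ (ℚ.positive⁻¹ _ {{ℚ.1/pos⇒pos d {{positive 0<d}}}}))
  where instance _ = ≢-nonZero d≢0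

*-/ℚ-assoc : ∀ c p d → (c * p) /ℚ d ≡ c * (p /ℚ d)
*-/ℚ-assoc c p d with d ℚ.≟ 0ℚ
... | yes _ = ≡-sym (ℚ.*-zeroʳ c)
... | no _ = ℚ.*-assoc c p _

≤-/ℚ-clear : ∀ {x y} L U U′ V V′ → 0ℚ < x → 0ℚ < y →
  x * y * L ≤ y * (U + U′) + x * (V + V′) →
  L ≤ (U /ℚ x + U′ /ℚ x) + (V /ℚ y + V′ /ℚ y)
≤-/ℚ-clear {x} {y} L U U′ V V′ 0<x 0<y xyL≤ =
  ℚ.*-cancelˡ-≤-pos (x * y) {{ℚ.pos*pos⇒pos x {{positive 0<x}} y {{positive 0<y}}}}
    (subst (x * y * L ≤_) (≡-sym cleared) xyL≤)
  where
  clear : ∀ {d} u u′ → 0ℚ < d → d * (u /ℚ d + u′ /ℚ d) ≡ u + u′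
  clear {d} u u′ 0<d = trans (ℚ.*-distribˡ-+ d _ _) (cong₂ _+_ (*-/ℚ u 0<d) (*-/ℚ u′ 0<d))
  cleared : x * y * ((U /ℚ x + U′ /ℚ x) + (V /ℚ y + V′ /ℚ y)) ≡ y * (U + U′) + x * (V + V′)
  cleared = begin
    x * y * (u + v)            ≡⟨ solve 4 (λ x y u v → x :* y :* (u :+ v) := y :* (x :* u) :+ x :* (y :* v)) refl x y u v ⟩
    y * (x * u) + x * (y * v)  ≡⟨ cong₂ (λ s t → y * s + x * t) (clear U U′ 0<x) (clear V V′ 0<y) ⟩
    y * (U + U′) + x * (V + V′) ∎
    where
    open ≡-Reasoning
    u v : ℚ
    u = U /ℚ x + U′ /ℚ x
    v = V /ℚ y + V′ /ℚ y

p≤p+q : ∀ {p q} → 0ℚ ≤ q → p ≤ p + q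
p≤p+q {p} 0≤q = subst (_≤ p + _) (ℚ.+-identityʳ p) (ℚ.+-monoʳ-≤ p 0≤q)

-- x = w_a, y = w_b, E_c = w²(N⁺_c), S_c = w²(C_c), T_c = Σ_{o ∈ C_c} δ w(N(o, A)),
-- ca = |C_a|, cb = |C_b|, M = #{o ∈ C_b : a ∈ N(o, A - b)} and
-- Z = Σ_{o ∈ C_b} w²(N(o, A - b) - a).
combine-bounds : ∀ {x y δ q g k ca cb M Ea Eb Sa Sb Ψa Ψb Ta Tb Z : ℚ} →
  0ℚ < x → x ≤ y → 0ℚ ≤ δ → 0ℚ ≤ q →
  Sa ≤ Ea → Sb ≤ Eb → Sa + Sb + x * x ≤ Ea + Eb → Eb ≤ y * y + (x * x + Z) →
  x * Ta ≤ Ψa + δ * (x * x) * ca →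
  y * Tb + (g - δ) * (y * y) * cb + x * ((1ℚ - δ) * y - x) * M + q * Z ≤ Ψb + q * Sb →
  ca + M ≤ k → 1ℚ ≤ M →
  ((1ℚ - q) - k * δ) * x + (cb * g - q - cb * δ) * y + (Ta + Tb)
    ≤ ((Ea - Sa) /ℚ x + Ψa /ℚ x) + ((Eb - Sb) /ℚ y + Ψb /ℚ y)
combine-bounds {x} {y} {δ} {q} {g} {k} {ca} {cb} {M} {Ea} {Eb} {Sa} {Sb} {Ψa} {Ψb} {Ta} {Tb} {Z}
  0<x x≤y 0≤δ 0≤q Sa≤Ea Sb≤Eb exchange-ab Eb-bound a-bound b-bound ca+M≤k 1≤M =
  ≤-/ℚ-clear L (Ea - Sa) Ψa (Eb - Sb) Ψb 0<x 0<y (0≤q-p⇒p≤q (subst (0ℚ ≤_) certificate slack-nonNeg))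
  where
  0<y : 0ℚ < y
  0<y = ℚ.<-≤-trans 0<x x≤y
  0≤x : 0ℚ ≤ x
  0≤x = ℚ.<⇒≤ 0<x
  0≤y : 0ℚ ≤ y
  0≤y = ℚ.<⇒≤ 0<y
  L : ℚ
  L = ((1ℚ - q) - k * δ) * x + (cb * g - q - cb * δ) * y + (Ta + Tb)
  slack : ℚ
  slack = y * ((Ψa + δ * (x * x) * ca) - x * Ta)
        + x * ((Ψb + q * Sb) - (y * Tb + (g - δ) * (y * y) * cb + x * ((1ℚ - δ) * y - x) * M + q * Z))
        + q * x * ((y * y + (x * x + Z)) - Eb)
        + δ * (x * x * y) * (k - (ca + M))
        + x * ((Ea + Eb) - (Sa + Sb + x * x))
        + (y - x) * (Ea - Sa) + q * x * (Eb - Sb)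
        + (M - 1ℚ) * (x * x) * (y - x) + q * (x * x) * (y - x)
  slack-nonNeg : 0ℚ ≤ slack
  slack-nonNeg =
    +-nonNeg (+-nonNeg (+-nonNeg (+-nonNeg (+-nonNeg (+-nonNeg (+-nonNeg (+-nonNeg
      (*-nonNeg 0≤y (p≤q⇒0≤q-p a-bound))
      (*-nonNeg 0≤x (p≤q⇒0≤q-p b-bound)))
      (*-nonNeg (*-nonNeg 0≤q 0≤x) (p≤q⇒0≤q-p Eb-bound)))
      (*-nonNeg (*-nonNeg 0≤δ (*-nonNeg (square-nonNeg x) 0≤y)) (p≤q⇒0≤q-p ca+M≤k)))
      (*-nonNeg 0≤x (p≤q⇒0≤q-p exchange-ab)))
      (*-nonNeg (p≤q⇒0≤q-p x≤y) (p≤q⇒0≤q-p Sa≤Ea)))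
      (*-nonNeg (*-nonNeg 0≤q 0≤x) (p≤q⇒0≤q-p Sb≤Eb)))
      (*-nonNeg (*-nonNeg (p≤q⇒0≤q-p 1≤M) (square-nonNeg x)) (p≤q⇒0≤q-p x≤y)))
      (*-nonNeg (*-nonNeg 0≤q (square-nonNeg x)) (p≤q⇒0≤q-p x≤y))
  certificate : slack ≡ y * ((Ea - Sa) + Ψa) + x * ((Eb - Sb) + Ψb) - x * y * L
  certificate = solve 18
    (λ x y δ q g k ca cb M Ea Eb Sa Sb Ψa Ψb Ta Tb Z →
        y :* ((Ψa :+ δ :* (x :* x) :* ca) :- x :* Ta)
      :+ x :* ((Ψb :+ q :* Sb)
               :- (y :* Tb :+ (g :- δ) :* (y :* y) :* cb :+ x :* ((con 1ℚ :- δ) :* y :- x) :* M :+ q :* Z))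
      :+ q :* x :* ((y :* y :+ (x :* x :+ Z)) :- Eb)
      :+ δ :* (x :* x :* y) :* (k :- (ca :+ M))
      :+ x :* ((Ea :+ Eb) :- (Sa :+ Sb :+ x :* x))
      :+ (y :- x) :* (Ea :- Sa) :+ q :* x :* (Eb :- Sb)
      :+ (M :- con 1ℚ) :* (x :* x) :* (y :- x) :+ q :* (x :* x) :* (y :- x)
      := y :* ((Ea :- Sa) :+ Ψa) :+ x :* ((Eb :- Sb) :+ Ψb)
         :- x :* y :* (((con 1ℚ :- q) :- k :* δ) :* x :+ (cb :* g :- q :- cb :* δ) :* y :+ (Ta :+ Tb)))
    refl x y δ q g k ca cb M Ea Eb Sa Sb Ψa Ψb Ta Tb Z

*-cancelˡ-≡-pos : ∀ {r p q} → 0ℚ < r → r * p ≡ r * q → p ≡ q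
*-cancelˡ-≡-pos {r} 0<r rp≡rq = ℚ.≤-antisym
  (ℚ.*-cancelˡ-≤-pos r {{positive 0<r}} (ℚ.≤-reflexive rp≡rq))
  (ℚ.*-cancelˡ-≤-pos r {{positive 0<r}} (ℚ.≤-reflexive (≡-sym rp≡rq)))

module Parameters (δ ε : ℚ) (δ≤ε : δ ≤ ε) (ε<1 : ε < 1ℚ) where

  q g : ℚ
  q = (ε - δ) /ℚ (1ℚ - ε)
  g = (ε - δ) /ℚ (1ℚ - δ)

  0<1-ε : 0ℚ < 1ℚ - ε
  0<1-ε = subst (_< 1ℚ - ε) (ℚ.+-inverseʳ ε) (ℚ.+-monoˡ-< (- ε) ε<1)

  0<1-δ : 0ℚ < 1ℚ - δ
  0<1-δ = subst (_< 1ℚ - δ) (ℚ.+-inverseʳ δ) (ℚ.+-monoˡ-< (- δ) (ℚ.≤-<-trans δ≤ε ε<1))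

  1-ε≤1-δ : 1ℚ - ε ≤ 1ℚ - δ
  1-ε≤1-δ = ℚ.+-monoʳ-≤ 1ℚ (ℚ.neg-antimono-≤ δ≤ε)

  0≤q : 0ℚ ≤ q
  0≤q = /ℚ-nonNeg (p≤q⇒0≤q-p δ≤ε) 0<1-ε

  [1+q][1-ε]≡1-δ : (1ℚ + q) * (1ℚ - ε) ≡ 1ℚ - δ
  [1+q][1-ε]≡1-δ = begin
    (1ℚ + q) * (1ℚ - ε)
      ≡⟨ solve 2 (λ q ε → (con 1ℚ :+ q) :* (con 1ℚ :- ε) := (con 1ℚ :- ε) :+ (con 1ℚ :- ε) :* q) refl q ε ⟩
    (1ℚ - ε) + (1ℚ - ε) * q
      ≡⟨ cong (_+_ (1ℚ - ε)) (*-/ℚ (ε - δ) 0<1-ε) ⟩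
    (1ℚ - ε) + (ε - δ)
      ≡⟨ solve 2 (λ ε δ → (con 1ℚ :- ε) :+ (ε :- δ) := con 1ℚ :- δ) refl ε δ ⟩
    1ℚ - δ
      ∎
    where open ≡-Reasoning

  [1+q]g≡q : (1ℚ + q) * g ≡ q
  [1+q]g≡q = *-cancelˡ-≡-pos 0<1-ε (begin
    (1ℚ - ε) * ((1ℚ + q) * g)  ≡⟨ solve 3 (λ e p g → e :* (p :* g) := (p :* e) :* g) refl (1ℚ - ε) (1ℚ + q) g ⟩
    ((1ℚ + q) * (1ℚ - ε)) * g  ≡⟨ cong (_* g) [1+q][1-ε]≡1-δ ⟩
    (1ℚ - δ) * g               ≡⟨ *-/ℚ (ε - δ) 0<1-δ ⟩
    ε - δ                      ≡⟨ *-/ℚ (ε - δ) 0<1-ε ⟨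
    (1ℚ - ε) * q               ∎)
    where open ≡-Reasoning

  0<1+q : 0ℚ < 1ℚ + q
  0<1+q = ℚ.<-≤-trans (ℚ.positive⁻¹ 1ℚ) (p≤p+q 0≤q)

  -- g = q / (1 + q) is the minimum of (t - 1)² + q t² over t.
  square-bound : ∀ t y → g * (y * y) ≤ (t - y) * (t - y) + q * (t * t)
  square-bound t y = ℚ.*-cancelˡ-≤-pos (1ℚ + q) {{positive 0<1+q}}
    (0≤q-p⇒p≤q (subst (0ℚ ≤_) completed-square (square-nonNeg ((1ℚ + q) * t - y))))
    where
    R : ℚ
    R = (t - y) * (t - y) + q * (t * t)
    completed-square : ((1ℚ + q) * t - y) * ((1ℚ + q) * t - y) ≡ (1ℚ + q) * R - (1ℚ + q) * (g * (y * y))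
    completed-square = begin
      ((1ℚ + q) * t - y) * ((1ℚ + q) * t - y)
        ≡⟨ solve 3 (λ q t y → ((con 1ℚ :+ q) :* t :- y) :* ((con 1ℚ :+ q) :* t :- y)
                      := (con 1ℚ :+ q) :* ((t :- y) :* (t :- y) :+ q :* (t :* t)) :- q :* (y :* y)) refl q t y ⟩
      (1ℚ + q) * R - q * (y * y)                ≡⟨ cong (λ s → (1ℚ + q) * R - s * (y * y)) [1+q]g≡q ⟨
      (1ℚ + q) * R - ((1ℚ + q) * g) * (y * y)   ≡⟨ cong (_-_ ((1ℚ + q) * R)) (ℚ.*-assoc (1ℚ + q) g (y * y)) ⟩
      (1ℚ + q) * R - (1ℚ + q) * (g * (y * y))   ∎
      where open ≡-Reasoning

ℕ→ℚ-suc : ∀ m → ℕ→ℚ (suc m) ≡ 1ℚ + ℕ→ℚ m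
ℕ→ℚ-suc m = ≡-sym (trans (cong (_+_ 1ℚ) ℕ→ℚ-normal) (ℚ./-cong numerators refl))
  where
  ℕ→ℚ-normal : ℕ→ℚ m ≡ mkℚ (+ m) 0 (sym (1-coprimeTo m))
  ℕ→ℚ-normal = ℚ.normalize-coprime (sym (1-coprimeTo m))
  numerators : + 1 ℤ.* + 1 ℤ.+ + m ℤ.* + 1 ≡ + suc m
  numerators = cong (λ t → + 1 ℤ.+ t) (ℤₚ.*-identityʳ (+ m))

ℕ→ℚ-mono : ∀ {m k} → m ℕ.≤ k → ℕ→ℚ m ≤ ℕ→ℚ k
ℕ→ℚ-mono {k = zero} ℕ.z≤n = ℚ.≤-refl
ℕ→ℚ-mono {k = suc k} ℕ.z≤n =
  subst₂ _≤_ (ℚ.+-identityʳ 0ℚ) (≡-sym (ℕ→ℚ-suc k))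
    (ℚ.+-mono-≤ (ℚ.nonNegative⁻¹ 1ℚ) (ℕ→ℚ-mono {k = k} ℕ.z≤n))
ℕ→ℚ-mono (ℕ.s≤s {m} {k} m≤k) =
  subst₂ _≤_ (≡-sym (ℕ→ℚ-suc m)) (≡-sym (ℕ→ℚ-suc k)) (ℚ.+-monoʳ-≤ 1ℚ (ℕ→ℚ-mono m≤k))

module ∑ = SemiringSum (Ring.semiring ℚ.+-*-ring)
open ∑ using (sum)

ΣFin≡sum : ∀ {n} (f : Fin n → ℚ) → ΣFin f ≡ sum f
ΣFin≡sum {zero} f = refl
ΣFin≡sum {suc n} f = cong (_+_ (f zero)) (ΣFin≡sum (f ∘ suc))

ΣFin-cong : ∀ {n} {f g : Fin n → ℚ} → (∀ i → f i ≡ g i) → ΣFin f ≡ ΣFin g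
ΣFin-cong {f = f} {g} f≗g rewrite ΣFin≡sum f | ΣFin≡sum g = ∑.sum-cong-≗ f≗g

ΣFin-+ : ∀ {n} (f g : Fin n → ℚ) → ΣFin (λ i → f i + g i) ≡ ΣFin f + ΣFin g
ΣFin-+ f g rewrite ΣFin≡sum (λ i → f i + g i) | ΣFin≡sum f | ΣFin≡sum g = ∑.∑-distrib-+ f g

ΣFin-* : ∀ {n} c (f : Fin n → ℚ) → ΣFin (λ i → c * f i) ≡ c * ΣFin f
ΣFin-* c f rewrite ΣFin≡sum (λ i → c * f i) | ΣFin≡sum f = ≡-sym (∑.*-distribˡ-sum c f)

ΣFin-zero : ∀ n → ΣFin {n} (λ _ → 0ℚ) ≡ 0ℚ
ΣFin-zero n rewrite ΣFin≡sum {n} (λ _ → 0ℚ) = ∑.sum-replicate-zero n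

ΣFin-comm : ∀ {m n} (f : Fin m → Fin n → ℚ) →
  ΣFin (λ i → ΣFin (f i)) ≡ ΣFin (λ j → ΣFin (λ i → f i j))
ΣFin-comm {m} {n} f = begin
  ΣFin (λ i → ΣFin (f i))          ≡⟨ ΣFin-cong (λ i → ΣFin≡sum (f i)) ⟩
  ΣFin (λ i → sum (f i))           ≡⟨ ΣFin≡sum (λ i → sum (f i)) ⟩
  sum (λ i → sum (f i))            ≡⟨ ∑.∑-comm f ⟩
  sum (λ j → sum (λ i → f i j))    ≡⟨ ΣFin≡sum (λ j → sum (λ i → f i j)) ⟨
  ΣFin (λ j → sum (λ i → f i j))   ≡⟨ ΣFin-cong (λ j → ΣFin≡sum (λ i → f i j)) ⟨
  ΣFin (λ j → ΣFin (λ i → f i j))  ∎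
  where open ≡-Reasoning

ΣFin-mono : ∀ {n} {f g : Fin n → ℚ} → (∀ i → f i ≤ g i) → ΣFin f ≤ ΣFin g
ΣFin-mono {zero} f≤g = ℚ.≤-refl
ΣFin-mono {suc n} f≤g = ℚ.+-mono-≤ (f≤g zero) (ΣFin-mono (f≤g ∘ suc))

ΣFin-nonNeg : ∀ {n} {f : Fin n → ℚ} → (∀ i → 0ℚ ≤ f i) → 0ℚ ≤ ΣFin f
ΣFin-nonNeg {n} {f} 0≤f = subst (_≤ ΣFin f) (ΣFin-zero n) (ΣFin-mono 0≤f)

ΣFin-single : ∀ {n} (a : Fin n) (f : Fin n → ℚ) →
  ΣFin (λ v → if does (v ≟ᶠ a) then f v else 0ℚ) ≡ f a
ΣFin-single {suc n} zero f = trans (cong (_+_ (f zero)) (ΣFin-zero n)) (ℚ.+-identityʳ (f zero))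
ΣFin-single {suc n} (suc a) f = trans (ℚ.+-identityˡ _) (ΣFin-single a (f ∘ suc))

T-∧⁻ : ∀ {x y} → T (x ∧ y) → T x × T y
T-∧⁻ = Equivalence.to T-∧

T-∧⁺ : ∀ {x y} → T x → T y → T (x ∧ y)
T-∧⁺ Tx Ty = Equivalence.from T-∧ (Tx , Ty)

T-∨⁻ : ∀ {x y} → T (x ∨ y) → T x ⊎ T y
T-∨⁻ = Equivalence.to T-∨

T-∨⁺ˡ : ∀ {x y} → T x → T (x ∨ y)
T-∨⁺ˡ Tx = Equivalence.from T-∨ (inj₁ Tx)

T-∨⁺ʳ : ∀ {x y} → T y → T (x ∨ y)
T-∨⁺ʳ Ty = Equivalence.from T-∨ (inj₂ Ty)

∈-｛｝⁻ : ∀ {n} {a v : Fin n} → v ∈ ｛ a ｝ → v ≡ a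
∈-｛｝⁻ {a = a} {v} v∈｛a｝ with v ≟ᶠ a
... | yes v≡a = v≡a

∈-｛｝⁺ : ∀ {n} (a : Fin n) → a ∈ ｛ a ｝
∈-｛｝⁺ a with a ≟ᶠ a
... | yes _ = tt
... | no a≢a = a≢a refl

｛｝⊆ : ∀ {n} {c} {X : VSet n} → c ∈ X → ｛ c ｝ ⊆ X
｛｝⊆ {X = X} c∈X v v∈｛c｝ = subst (_∈ X) (≡-sym (∈-｛｝⁻ v∈｛c｝)) c∈X

∈-－⁻ : ∀ {n} {X : VSet n} {a v} → v ∈ (X － a) → v ∈ X × v ≢ a
∈-－⁻ {X = X} {a} {v} v∈X－a with v ≟ᶠ a
... | no v≢a = subst T (∧-identityʳ (X v)) v∈X－a , v≢a
... | yes _ = ⊥-elim (subst T (∧-zeroʳ (X v)) v∈X－a)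

anyFin⁺ : ∀ {m} (g : Fin m → Bool) i → T (g i) → T (anyFin g)
anyFin⁺ g zero gi = T-∨⁺ˡ gi
anyFin⁺ g (suc i) gi = T-∨⁺ʳ (anyFin⁺ (g ∘ suc) i gi)

anyFin⁻ : ∀ {m} (g : Fin m → Bool) → T (anyFin g) → ∃[ i ] T (g i)
anyFin⁻ {suc m} g any with T-∨⁻ any
... | inj₁ g0 = zero , g0
... | inj₂ any′ = let i , gi = anyFin⁻ (g ∘ suc) any′ in suc i , gi

anyFin-cong : ∀ {m} {f g : Fin m → Bool} → (∀ i → f i ≡ g i) → anyFin f ≡ anyFin g
anyFin-cong {zero} f≗g = refl
anyFin-cong {suc m} f≗g = cong₂ _∨_ (f≗g zero) (anyFin-cong (f≗g ∘ suc))

anyFin-∨ : ∀ {m} (f g : Fin m → Bool) → anyFin (λ i → f i ∨ g i) ≡ anyFin f ∨ anyFin g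
anyFin-∨ {zero} f g = refl
anyFin-∨ {suc m} f g = trans (cong (_∨_ (f zero ∨ g zero)) (anyFin-∨ (f ∘ suc) (g ∘ suc)))
  (∨-interchange (f zero) (g zero) (anyFin (f ∘ suc)) (anyFin (g ∘ suc)))

anyFin-｛｝ : ∀ {m} (a : Fin m) (g : Fin m → Bool) → anyFin (λ x → ｛ a ｝ x ∧ g x) ≡ g a
anyFin-｛｝ {suc m} zero g = trans (cong (_∨_ (g zero)) (anyFin-false m)) (∨-identityʳ (g zero))
  where
  anyFin-false : ∀ m → anyFin {m} (λ _ → false) ≡ false
  anyFin-false zero = refl
  anyFin-false (suc m) = anyFin-false m
anyFin-｛｝ {suc m} (suc a) g = anyFin-｛｝ a (g ∘ suc)

∈-⋃⁺ : ∀ {n} {X : VSet n} {F : Fin n → VSet n} {x v} → x ∈ X → v ∈ F x → v ∈ ⋃ X F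
∈-⋃⁺ {x = x} x∈X v∈Fx = anyFin⁺ _ x (T-∧⁺ x∈X v∈Fx)

∈-⋃⁻ : ∀ {n} {X : VSet n} {F : Fin n → VSet n} {v} → v ∈ ⋃ X F → ∃[ x ] (x ∈ X × v ∈ F x)
∈-⋃⁻ v∈⋃ = let x , x∈X∩Fx = anyFin⁻ _ v∈⋃ in x , T-∧⁻ x∈X∩Fx

⋃-｛｝ : ∀ {n} (a : Fin n) (F : Fin n → VSet n) v → ⋃ ｛ a ｝ F v ≡ F a v
⋃-｛｝ a F v = anyFin-｛｝ a (λ x → F x v)

⋃-∪ : ∀ {n} (X Y : VSet n) (F : Fin n → VSet n) v → ⋃ (X ∪ Y) F v ≡ (⋃ X F ∪ ⋃ Y F) v
⋃-∪ X Y F v = trans (anyFin-cong (λ x → ∧-distribʳ-∨ (F x v) (X x) (Y x)))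
  (anyFin-∨ (λ x → X x ∧ F x v) (λ x → Y x ∧ F x v))

⋃-pair : ∀ {n} (a b : Fin n) (F : Fin n → VSet n) v → ⋃ (｛ a ｝ ∪ ｛ b ｝) F v ≡ (F a ∪ F b) v
⋃-pair a b F v = trans (⋃-∪ ｛ a ｝ ｛ b ｝ F v) (cong₂ _∨_ (⋃-｛｝ a F v) (⋃-｛｝ b F v))

∈-｛｝∪－ : ∀ {n} {X : VSet n} {a v} → v ∈ X → v ∈ (｛ a ｝ ∪ (X － a))
∈-｛｝∪－ {a = a} {v} v∈X with v ≟ᶠ a
... | yes _ = tt
... | no _ = T-∧⁺ v∈X tt

∈-∪⁺ˡ : ∀ {n} (X Y : VSet n) {v} → v ∈ X → v ∈ (X ∪ Y)
∈-∪⁺ˡ X Y = T-∨⁺ˡ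

∈-∪⁺ʳ : ∀ {n} (X Y : VSet n) {v} → v ∈ Y → v ∈ (X ∪ Y)
∈-∪⁺ʳ X Y {v} = T-∨⁺ʳ {X v}

∈-Nv⁻ : ∀ {n} {G : Graph n} {o Y v} → v ∈ Nv G o Y → v ∈ Y × (adj G o v ≡ true ⊎ v ≡ o)
∈-Nv⁻ {G = G} {o} {Y} {v} v∈N with T-∨⁻ v∈N
... | inj₁ v∈Y∧adj = let v∈Y , adjacent = T-∧⁻ v∈Y∧adj in
  v∈Y , inj₁ (Equivalence.to T-≡ (subst T (anyFin-｛｝ o (λ x → adj G x v)) adjacent))
... | inj₂ v≡o∧v∈Y = let v≡o , v∈Y = T-∧⁻ v≡o∧v∈Y in v∈Y , inj₂ (∈-｛｝⁻ v≡o)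

Nv-－ : ∀ {n} (G : Graph n) o (Y : VSet n) a v → Nv G o (Y － a) v ≡ (Nv G o Y － a) v
Nv-－ G o Y a v = ∧-distrib (Y v) (not (does (v ≟ᶠ a))) _ _
  where
  ∧-distrib : ∀ y e p s → ((y ∧ e) ∧ p) ∨ (s ∧ (y ∧ e)) ≡ ((y ∧ p) ∨ (s ∧ y)) ∧ e
  ∧-distrib y true p s rewrite ∧-identityʳ y | ∧-identityʳ ((y ∧ p) ∨ (s ∧ y)) = refl
  ∧-distrib y false p s rewrite ∧-zeroʳ y | ∧-zeroʳ s | ∧-zeroʳ ((y ∧ p) ∨ (s ∧ y)) = refl

Nv-independent : ∀ {n} {G : Graph n} {X Y : VSet n} {u v} → Independent G X →
  u ∈ X → v ∈ X → v ∈ Nv G u Y → v ≡ u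
Nv-independent {G = G} {Y = Y} X-independent u∈X v∈X v∈N with proj₂ (∈-Nv⁻ {G = G} {Y = Y} v∈N)
... | inj₁ adj≡true = ⊥-elim (true≢false (trans (≡-sym adj≡true) (X-independent _ _ u∈X v∈X)))
  where
  true≢false : true ≢ false
  true≢false ()
... | inj₂ v≡u = v≡u

Nv-－⊆ : ∀ {n} {G : Graph n} {o} {Y : VSet n} {a v} → v ∈ Nv G o (Y － a) → v ∈ Nv G o Y
Nv-－⊆ {G = G} {o} {Y} {a} {v} v∈N = proj₁ (∈-－⁻ {X = Nv G o Y} (subst T (Nv-－ G o Y a v) v∈N))

_↾_ : ∀ {n} → VSet n → (Fin n → ℚ) → Fin n → ℚ
(X ↾ f) v = if X v then f v else 0ℚ

if-cong : ∀ b {p q} → (T b → p ≡ q) → (if b then p else 0ℚ) ≡ (if b then q else 0ℚ)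
if-cong true p≡q = p≡q tt
if-cong false _ = refl

if-mono : ∀ b {p q} → (T b → p ≤ q) → (if b then p else 0ℚ) ≤ (if b then q else 0ℚ)
if-mono true p≤q = p≤q tt
if-mono false _ = ℚ.≤-refl

if-nonNeg : ∀ b {p} → (T b → 0ℚ ≤ p) → 0ℚ ≤ (if b then p else 0ℚ)
if-nonNeg true 0≤p = 0≤p tt
if-nonNeg false _ = ℚ.≤-refl

if-anyFin-≤ : ∀ {m} (g : Fin m → Bool) {p} → 0ℚ ≤ p →
  (if anyFin g then p else 0ℚ) ≤ ΣFin (λ i → if g i then p else 0ℚ)
if-anyFin-≤ {zero} g 0≤p = ℚ.≤-refl
if-anyFin-≤ {suc m} g {p} 0≤p with g zero
... | true = p≤p+q (ΣFin-nonNeg (λ i → if-nonNeg (g (suc i)) (λ _ → 0≤p)))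
... | false = subst ((if anyFin (g ∘ suc) then p else 0ℚ) ≤_) (≡-sym (ℚ.+-identityˡ _)) (if-anyFin-≤ (g ∘ suc) 0≤p)

Σ∈-cong : ∀ {n} (X : VSet n) {f g : Fin n → ℚ} → (∀ v → v ∈ X → f v ≡ g v) → Σ∈ X f ≡ Σ∈ X g
Σ∈-cong X f≗g = ΣFin-cong (λ v → if-cong (X v) (f≗g v))

Σ∈-cong-set : ∀ {n} {X Y : VSet n} (f : Fin n → ℚ) → (∀ v → X v ≡ Y v) → Σ∈ X f ≡ Σ∈ Y f
Σ∈-cong-set f X≗Y = ΣFin-cong (λ v → cong (λ b → if b then f v else 0ℚ) (X≗Y v))

Σ∈-mono : ∀ {n} (X : VSet n) {f g : Fin n → ℚ} → (∀ v → v ∈ X → f v ≤ g v) → Σ∈ X f ≤ Σ∈ X g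
Σ∈-mono X f≤g = ΣFin-mono (λ v → if-mono (X v) (f≤g v))

Σ∈-nonNeg : ∀ {n} (X : VSet n) {f : Fin n → ℚ} → (∀ v → v ∈ X → 0ℚ ≤ f v) → 0ℚ ≤ Σ∈ X f
Σ∈-nonNeg X 0≤f = ΣFin-nonNeg (λ v → if-nonNeg (X v) (0≤f v))

Σ∈-+ : ∀ {n} (X : VSet n) (f g : Fin n → ℚ) → Σ∈ X (λ v → f v + g v) ≡ Σ∈ X f + Σ∈ X g
Σ∈-+ X f g = trans (ΣFin-cong (λ v → if-+ (X v))) (ΣFin-+ (X ↾ f) (X ↾ g))
  where
  if-+ : ∀ b {p q} → (if b then p + q else 0ℚ) ≡ (if b then p else 0ℚ) + (if b then q else 0ℚ)
  if-+ true = refl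
  if-+ false = ≡-sym (ℚ.+-identityʳ 0ℚ)

Σ∈-* : ∀ {n} (X : VSet n) c (f : Fin n → ℚ) → Σ∈ X (λ v → c * f v) ≡ c * Σ∈ X f
Σ∈-* X c f = trans (ΣFin-cong (λ v → if-* (X v))) (ΣFin-* c (X ↾ f))
  where
  if-* : ∀ b {p} → (if b then c * p else 0ℚ) ≡ c * (if b then p else 0ℚ)
  if-* true = refl
  if-* false = ≡-sym (ℚ.*-zeroʳ c)

card≡Σ∈ : ∀ {n} (X : VSet n) → ℕ→ℚ (card X) ≡ Σ∈ X (λ _ → 1ℚ)
card≡Σ∈ {zero} X = refl
card≡Σ∈ {suc n} X with X zero
... | true = trans (ℕ→ℚ-suc (card (X ∘ suc))) (cong (_+_ 1ℚ) (card≡Σ∈ (X ∘ suc)))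
... | false = trans (card≡Σ∈ (X ∘ suc)) (≡-sym (ℚ.+-identityˡ (Σ∈ (X ∘ suc) (λ _ → 1ℚ))))

Σ∈-const : ∀ {n} (X : VSet n) c → Σ∈ X (λ _ → c) ≡ c * ℕ→ℚ (card X)
Σ∈-const X c = begin
  Σ∈ X (λ _ → c)       ≡⟨ Σ∈-cong X (λ _ _ → ℚ.*-identityʳ c) ⟨
  Σ∈ X (λ _ → c * 1ℚ)  ≡⟨ Σ∈-* X c (λ _ → 1ℚ) ⟩
  c * Σ∈ X (λ _ → 1ℚ)  ≡⟨ cong (c *_) (card≡Σ∈ X) ⟨
  c * ℕ→ℚ (card X)     ∎
  where open ≡-Reasoning

Σ∈-∩ : ∀ {n} (X Y : VSet n) (f : Fin n → ℚ) → Σ∈ (X ∩ Y) f ≡ Σ∈ X (Y ↾ f)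
Σ∈-∩ X Y f = ΣFin-cong (λ v → if-∧ (X v))
  where
  if-∧ : ∀ x {y p} → (if x ∧ y then p else 0ℚ) ≡ (if x then (if y then p else 0ℚ) else 0ℚ)
  if-∧ true = refl
  if-∧ false = refl

Σ∈-∪-∩ : ∀ {n} (X Y : VSet n) (f : Fin n → ℚ) →
  Σ∈ (X ∪ Y) f + Σ∈ (X ∩ Y) f ≡ Σ∈ X f + Σ∈ Y f
Σ∈-∪-∩ X Y f =
  trans (≡-sym (ΣFin-+ ((X ∪ Y) ↾ f) ((X ∩ Y) ↾ f)))
    (trans (ΣFin-cong (λ v → inclusion–exclusion (X v) (Y v) (f v))) (ΣFin-+ (X ↾ f) (Y ↾ f)))
  where
  inclusion–exclusion : ∀ x y p →
    (if x ∨ y then p else 0ℚ) + (if x ∧ y then p else 0ℚ) ≡ (if x then p else 0ℚ) + (if y then p else 0ℚ)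
  inclusion–exclusion true true _ = refl
  inclusion–exclusion true false _ = refl
  inclusion–exclusion false true p = ℚ.+-comm p 0ℚ
  inclusion–exclusion false false _ = refl

Σ∈-∅ : ∀ {n} (X : VSet n) (f : Fin n → ℚ) → (∀ v → ¬ v ∈ X) → Σ∈ X f ≡ 0ℚ
Σ∈-∅ {n} X f X-empty = trans (ΣFin-cong (λ v → if-false (X v) (X-empty v))) (ΣFin-zero n)
  where
  if-false : ∀ b {p} → ¬ T b → (if b then p else 0ℚ) ≡ 0ℚ
  if-false true ¬T = ⊥-elim (¬T tt)
  if-false false _ = refl

Σ∈-∪-disjoint : ∀ {n} (X Y : VSet n) (f : Fin n → ℚ) → (∀ v → v ∈ X → v ∈ Y → ⊥) →
  Σ∈ (X ∪ Y) f ≡ Σ∈ X f + Σ∈ Y f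
Σ∈-∪-disjoint X Y f disjoint = begin
  Σ∈ (X ∪ Y) f                 ≡⟨ ℚ.+-identityʳ _ ⟨
  Σ∈ (X ∪ Y) f + 0ℚ            ≡⟨ cong (_+_ (Σ∈ (X ∪ Y) f)) X∩Y≡0 ⟨
  Σ∈ (X ∪ Y) f + Σ∈ (X ∩ Y) f  ≡⟨ Σ∈-∪-∩ X Y f ⟩
  Σ∈ X f + Σ∈ Y f              ∎
  where
  open ≡-Reasoning
  X∩Y≡0 : Σ∈ (X ∩ Y) f ≡ 0ℚ
  X∩Y≡0 = Σ∈-∅ (X ∩ Y) f (λ v v∈X∩Y → let v∈X , v∈Y = T-∧⁻ v∈X∩Y in disjoint v v∈X v∈Y)

Σ∈-∪ : ∀ {n} (X Y : VSet n) {f : Fin n → ℚ} → (∀ v → 0ℚ ≤ f v) →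
  Σ∈ (X ∪ Y) f ≤ Σ∈ X f + Σ∈ Y f
Σ∈-∪ X Y {f} 0≤f = subst (Σ∈ (X ∪ Y) f ≤_) (Σ∈-∪-∩ X Y f) (p≤p+q (Σ∈-nonNeg (X ∩ Y) (λ v _ → 0≤f v)))

Σ∈-⊆ : ∀ {n} {X Y : VSet n} {f : Fin n → ℚ} → X ⊆ Y → (∀ v → v ∈ Y → 0ℚ ≤ f v) →
  Σ∈ X f ≤ Σ∈ Y f
Σ∈-⊆ {X = X} {Y} X⊆Y 0≤f = ΣFin-mono (λ v → if-⊆ (X v) (Y v) (X⊆Y v) (0≤f v))
  where
  if-⊆ : ∀ x y {p} → (T x → T y) → (T y → 0ℚ ≤ p) → (if x then p else 0ℚ) ≤ (if y then p else 0ℚ)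
  if-⊆ true true _ _ = ℚ.≤-refl
  if-⊆ true false x⇒y _ = ⊥-elim (x⇒y tt)
  if-⊆ false true _ 0≤p = 0≤p tt
  if-⊆ false false _ _ = ℚ.≤-refl

Σ∈-｛｝ : ∀ {n} (a : Fin n) (f : Fin n → ℚ) → Σ∈ ｛ a ｝ f ≡ f a
Σ∈-｛｝ = ΣFin-single

Σ∈-term : ∀ {n} {X : VSet n} {f : Fin n → ℚ} {a} → a ∈ X → (∀ v → v ∈ X → 0ℚ ≤ f v) → f a ≤ Σ∈ X f
Σ∈-term {X = X} {f} {a} a∈X 0≤f = subst (_≤ Σ∈ X f) (Σ∈-｛｝ a f) (Σ∈-⊆ (｛｝⊆ a∈X) 0≤f)

Σ∈-split : ∀ {n} (S : VSet n) (a : Fin n) (f : Fin n → ℚ) → Σ∈ S f ≡ (S ↾ f) a + Σ∈ (S － a) f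
Σ∈-split S a f =
  trans (ΣFin-cong (λ v → if-split (S v) (does (v ≟ᶠ a)) (f v)))
    (trans (ΣFin-+ (λ v → if does (v ≟ᶠ a) then (S ↾ f) v else 0ℚ) ((S － a) ↾ f))
      (cong (_+ Σ∈ (S － a) f) (ΣFin-single a (S ↾ f))))
  where
  if-split : ∀ s e p →
    (if s then p else 0ℚ) ≡ (if e then (if s then p else 0ℚ) else 0ℚ) + (if s ∧ not e then p else 0ℚ)
  if-split true true _ = ≡-sym (ℚ.+-identityʳ _)
  if-split true false _ = ≡-sym (ℚ.+-identityˡ _)
  if-split false true _ = ≡-sym (ℚ.+-identityʳ 0ℚ)
  if-split false false _ = ≡-sym (ℚ.+-identityʳ 0ℚ)

Σ∈-⋃ : ∀ {n} (X : VSet n) (F : Fin n → VSet n) {f : Fin n → ℚ} → (∀ v → 0ℚ ≤ f v) →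
  Σ∈ (⋃ X F) f ≤ Σ∈ X (λ x → Σ∈ (F x) f)
Σ∈-⋃ {n} X F {f} 0≤f = begin
  Σ∈ (⋃ X F) f
    ≤⟨ ΣFin-mono (λ v → if-anyFin-≤ (λ x → X x ∧ F x v) (0≤f v)) ⟩
  ΣFin (λ v → ΣFin (λ x → if X x ∧ F x v then f v else 0ℚ))
    ≡⟨ ΣFin-comm (λ v x → if X x ∧ F x v then f v else 0ℚ) ⟩
  ΣFin (λ x → ΣFin (λ v → if X x ∧ F x v then f v else 0ℚ))
    ≡⟨ ΣFin-cong (λ x → restrict (X x)) ⟩
  Σ∈ X (λ x → Σ∈ (F x) f)
    ∎
  where
  open ℚ.≤-Reasoning
  restrict : ∀ b {x} → ΣFin (λ v → if b ∧ F x v then f v else 0ℚ) ≡ (if b then Σ∈ (F x) f else 0ℚ)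
  restrict true = refl
  restrict false = ΣFin-zero n

𝟙 : Bool → ℚ
𝟙 b = if b then 1ℚ else 0ℚ

if≡𝟙* : ∀ b p → (if b then p else 0ℚ) ≡ 𝟙 b * p
if≡𝟙* true p = ≡-sym (ℚ.*-identityˡ p)
if≡𝟙* false p = ≡-sym (ℚ.*-zeroˡ p)

if-T : ∀ {b} p → T b → (if b then p else 0ℚ) ≡ p
if-T {true} p _ = refl

Σ∈-𝟙 : ∀ {n} (X Y : VSet n) c → Σ∈ X (λ v → 𝟙 (Y v) * c) ≡ c * ℕ→ℚ (card (X ∩ Y))
Σ∈-𝟙 X Y c = begin
  Σ∈ X (λ v → 𝟙 (Y v) * c)             ≡⟨ Σ∈-cong X (λ v _ → if≡𝟙* (Y v) c) ⟨
  Σ∈ X (Y ↾ (λ _ → c))               ≡⟨ Σ∈-∩ X Y (λ _ → c) ⟨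
  Σ∈ (X ∩ Y) (λ _ → c)                ≡⟨ Σ∈-const (X ∩ Y) c ⟩
  c * ℕ→ℚ (card (X ∩ Y))              ∎
  where open ≡-Reasoning

Σ∈-square-≤ : ∀ {n} (S : VSet n) (f : Fin n → ℚ) {α β} → (∀ u → 0ℚ ≤ f u) →
  (∀ u → u ∈ S → β * f u ≤ α) → β * Σ∈ S (λ u → f u * f u) ≤ α * Σ∈ S f
Σ∈-square-≤ S f {α} {β} 0≤f βf≤α =
  subst₂ _≤_ (Σ∈-* S β (λ u → f u * f u)) (Σ∈-* S α f) (Σ∈-mono S termwise)
  where
  termwise : ∀ u → u ∈ S → β * (f u * f u) ≤ α * f u
  termwise u u∈S = subst (_≤ α * f u) (ℚ.*-assoc β (f u) (f u))
    (ℚ.*-monoʳ-≤-nonNeg (f u) {{nonNegative (0≤f u)}} (βf≤α u u∈S))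

card-∅ : ∀ n → card {n} (λ _ → false) ≡ 0
card-∅ zero = refl
card-∅ (suc n) = card-∅ n

card-cong : ∀ {n} {X Y : VSet n} → (∀ v → X v ≡ Y v) → card X ≡ card Y
card-cong {zero} X≗Y = refl
card-cong {suc n} X≗Y = cong₂ ℕ._+_ (cong (λ b → if b then 1 else 0) (X≗Y zero)) (card-cong (X≗Y ∘ suc))

card-｛｝ : ∀ {n} (a : Fin n) → card ｛ a ｝ ≡ 1
card-｛｝ {suc n} zero = cong suc (card-∅ n)
card-｛｝ {suc n} (suc a) = card-｛｝ a

card-｛｝∪｛｝ : ∀ {n} {a b : Fin n} → a ≢ b → card (｛ a ｝ ∪ ｛ b ｝) ≡ 2
card-｛｝∪｛｝ {suc n} {zero} {zero} a≢b = ⊥-elim (a≢b refl)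
card-｛｝∪｛｝ {suc n} {zero} {suc b} _ = cong suc (card-｛｝ b)
card-｛｝∪｛｝ {suc n} {suc a} {zero} _ =
  cong suc (trans (card-cong (λ v → ∨-identityʳ (does (v ≟ᶠ a)))) (card-｛｝ a))
card-｛｝∪｛｝ {suc n} {suc a} {suc b} a≢b = card-｛｝∪｛｝ (a≢b ∘ cong suc)

enumerate : ∀ {n} (X : VSet n) →
  Σ (Fin (card X) → Fin n) λ f → (∀ i j → f i ≡ f j → i ≡ j) × (∀ i → f i ∈ X)
enumerate {zero} X = (λ ()) , (λ ()) , (λ ())
enumerate {suc n} X with X zero in X0 | enumerate (X ∘ suc)
... | true | f , f-injective , f∈X = g , g-injective , g∈X
  where
  g : Fin (suc (card (X ∘ suc))) → Fin (suc n)
  g zero = zero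
  g (suc i) = suc (f i)
  g-injective : ∀ i j → g i ≡ g j → i ≡ j
  g-injective zero zero _ = refl
  g-injective (suc i) (suc j) gi≡gj = cong suc (f-injective i j (suc-injective gi≡gj))
  g∈X : ∀ i → g i ∈ X
  g∈X zero = subst T (≡-sym X0) tt
  g∈X (suc i) = f∈X i
... | false | f , f-injective , f∈X =
  suc ∘ f , (λ i j fi≡fj → f-injective i j (suc-injective fi≡fj)) , f∈X

independent-neighbours-≤ : ∀ {n} {G : Graph n} {k} → ClawFree (suc k) G →
  ∀ c (D : VSet n) → (∀ v → v ∈ D → adj G c v ≡ true) → Independent G D → card D ℕ.≤ k
independent-neighbours-≤ {n} {G} {k} claw-free c D D⊆N[c] D-independent with card D ℕ.≤? k | enumerate D
... | yes |D|≤k | _ = |D|≤k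
... | no |D|≰k | f , f-injective , f∈D =
  ⊥-elim (claw-free (c , leaf , leaves-distinct , leaves-independent , leaves-adjacent))
  where
  leaf : Fin (suc k) → Fin n
  leaf i = f (inject≤ i (ℕ.≰⇒> |D|≰k))
  leaves-distinct : ∀ i j → i ≢ j → leaf i ≢ leaf j
  leaves-distinct i j i≢j leaf≡ = i≢j (inject≤-injective _ _ i j (f-injective _ _ leaf≡))
  leaves-independent : ∀ i j → i ≢ j → adj G (leaf i) (leaf j) ≡ false
  leaves-independent i j _ = D-independent _ _ (f∈D _) (f∈D _)
  leaves-adjacent : ∀ i → adj G c (leaf i) ≡ true
  leaves-adjacent i = D⊆N[c] _ (f∈D _)

module Charging {n} (G : Graph n) (w : Weight n) (O A : VSet n) (π : Fin n → Fin n)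
  (π-heaviest : ∀ o → o ∈ O → π o ∈ Nv G o A × (∀ a → a ∈ Nv G o A → w a ≤ w (π o))) where

  open Setup G w O A π

  ∈-C⁻ : ∀ {c o} → o ∈ C c → o ∈ O × π o ≡ c
  ∈-C⁻ {c} {o} o∈Cc = let o∈O , πo∈｛c｝ = T-∧⁻ {O o} o∈Cc in o∈O , ∈-｛｝⁻ {a = c} {π o} πo∈｛c｝

  C-functional : ∀ {c d o} → o ∈ C c → o ∈ C d → c ≡ d
  C-functional o∈Cc o∈Cd = trans (≡-sym (proj₂ (∈-C⁻ o∈Cc))) (proj₂ (∈-C⁻ o∈Cd))

  charged-to-neighbour : ∀ {c o} → o ∈ C c → c ∈ Nv G o A
  charged-to-neighbour {o = o} o∈Cc =
    subst (λ c → c ∈ Nv G o A) (proj₂ (∈-C⁻ o∈Cc)) (proj₁ (π-heaviest o (proj₁ (∈-C⁻ o∈Cc))))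

  charged-to-heaviest : ∀ {c o u} → o ∈ C c → u ∈ Nv G o A → w u ≤ w c
  charged-to-heaviest {o = o} {u} o∈Cc u∈N =
    subst (λ c → w u ≤ w c) (proj₂ (∈-C⁻ o∈Cc)) (proj₂ (π-heaviest o (proj₁ (∈-C⁻ o∈Cc))) u u∈N)

  c∈N⁺c : ∀ c → c ∈ N⁺ c
  c∈N⁺c c = T-∨⁺ˡ (∈-｛｝⁺ c)

  N⊆N⁺ : ∀ {c o u} → o ∈ C c → u ∈ Nv G o (A － c) → u ∈ N⁺ c
  N⊆N⁺ {c} o∈Cc u∈N = T-∨⁺ʳ (∈-⋃⁺ {X = C c} {F = λ o → Nv G o (A － c)} o∈Cc u∈N)

  ∈-N⁺⁻ : ∀ {c u} → u ∈ N⁺ c → u ≡ c ⊎ ∃[ o ] (o ∈ C c × u ∈ Nv G o (A － c))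
  ∈-N⁺⁻ {c} u∈N⁺ with T-∨⁻ u∈N⁺
  ... | inj₁ u∈｛c｝ = inj₁ (∈-｛｝⁻ u∈｛c｝)
  ... | inj₂ u∈⋃ = inj₂ (∈-⋃⁻ {X = C c} {F = λ o → Nv G o (A － c)} u∈⋃)

  w-N-split : ∀ {c o} → o ∈ C c → w[ w ] (Nv G o A) ≡ w c + w[ w ] (Nv G o (A － c))
  w-N-split {c} {o} o∈Cc = trans (Σ∈-split (Nv G o A) c w)
    (cong₂ _+_ (if-T (w c) (charged-to-neighbour o∈Cc)) (Σ∈-cong-set w (λ v → ≡-sym (Nv-－ G o A c v))))

  light-neighbour : ∀ ε {c o u} → c ∈ A → o ∈ C c → u ∈ Nv G o (A － c) → ¬ Arc ε u c →
    w u ≤ (1ℚ - ε) * w c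
  light-neighbour ε {c} {o} {u} c∈A o∈Cc u∈N no-arc with (1ℚ - ε) * w c ℚ.≤? w u
  ... | no light = ℚ.<⇒≤ (ℚ.≰⇒> light)
  ... | yes heavy =
    let u∈A , u≢c = ∈-－⁻ {X = A} (proj₁ (∈-Nv⁻ {G = G} {Y = A － c} u∈N)) in
    ⊥-elim (no-arc (u∈A , c∈A , u≢c , N⊆N⁺ {c} o∈Cc u∈N , heavy))

  exchange-single : LocallyOptimal 2 → ∀ {c} → c ∈ A → w²[ w ] (C c) ≤ w²[ w ] (N⁺ c)
  exchange-single locally-optimal {c} c∈A =
    subst₂ _≤_ (Σ∈-cong-set (λ v → w v * w v) (⋃-｛｝ c C)) (Σ∈-cong-set (λ v → w v * w v) (⋃-｛｝ c N⁺))
      (locally-optimal ｛ c ｝ (｛｝⊆ c∈A) (ℕ.≤-reflexive (≡-sym (card-｛｝ c)))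
        (subst (ℕ._≤ 2) (≡-sym (card-｛｝ c)) (ℕ.s≤s ℕ.z≤n)))

  exchange-pair : LocallyOptimal 2 → ∀ {c d} → c ∈ A → d ∈ A → c ≢ d →
    w²[ w ] (C c ∪ C d) ≤ w²[ w ] (N⁺ c ∪ N⁺ d)
  exchange-pair locally-optimal {c} {d} c∈A d∈A c≢d =
    subst₂ _≤_ (Σ∈-cong-set (λ v → w v * w v) (⋃-pair c d C)) (Σ∈-cong-set (λ v → w v * w v) (⋃-pair c d N⁺))
      (locally-optimal (｛ c ｝ ∪ ｛ d ｝) pair⊆A
        (subst (1 ℕ.≤_) (≡-sym (card-｛｝∪｛｝ c≢d)) (ℕ.s≤s ℕ.z≤n)) (ℕ.≤-reflexive (card-｛｝∪｛｝ c≢d)))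
    where
    pair⊆A : (｛ c ｝ ∪ ｛ d ｝) ⊆ A
    pair⊆A v v∈pair with T-∨⁻ v∈pair
    ... | inj₁ v∈｛c｝ = ｛｝⊆ c∈A v v∈｛c｝
    ... | inj₂ v∈｛d｝ = ｛｝⊆ d∈A v v∈｛d｝

  module IsolatedEdgeBounds {k} (claw-free : ClawFree (suc k) G) (w>0 : ∀ v → 0ℚ < w v)
    (O-independent : Independent G O) (A-independent : Independent G A)
    (locally-optimal : LocallyOptimal 2)
    (δ ε : ℚ) (0≤δ : 0ℚ ≤ δ) (δ≤ε : δ ≤ ε) (ε<1 : ε < 1ℚ)
    {a b : Fin n} (isolated : IsolatedEdge ε a b) where

    open Parameters δ ε δ≤ε ε<1

    0≤w : ∀ v → 0ℚ ≤ w v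
    0≤w v = ℚ.<⇒≤ (w>0 v)

    0≤w² : ∀ v → 0ℚ ≤ w v * w v
    0≤w² v = square-nonNeg (w v)

    a∈A : a ∈ A
    a∈A = proj₁ (proj₁ isolated)

    b∈A : b ∈ A
    b∈A = proj₁ (proj₂ (proj₁ isolated))

    a≢b : a ≢ b
    a≢b = proj₁ (proj₂ (proj₂ (proj₁ isolated)))

    a∈N⁺b : a ∈ N⁺ b
    a∈N⁺b = proj₁ (proj₂ (proj₂ (proj₂ (proj₁ isolated))))

    a-witness : ∃[ o ] (o ∈ C b × a ∈ Nv G o (A － b))
    a-witness with ∈-N⁺⁻ {b} a∈N⁺b
    ... | inj₁ a≡b = ⊥-elim (a≢b a≡b)
    ... | inj₂ witness = witness

    o₀ : Fin n
    o₀ = proj₁ a-witness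

    o₀∈Cb : o₀ ∈ C b
    o₀∈Cb = proj₁ (proj₂ a-witness)

    a∈N[o₀] : a ∈ Nv G o₀ (A － b)
    a∈N[o₀] = proj₂ (proj₂ a-witness)

    a∉O : ¬ a ∈ O
    a∉O a∈O = a≢b (trans a≡o₀ (≡-sym b≡o₀))
      where
      a≡o₀ : a ≡ o₀
      a≡o₀ = Nv-independent {G = G} {Y = A － b} O-independent (proj₁ (∈-C⁻ {b} o₀∈Cb)) a∈O a∈N[o₀]
      b≡o₀ : b ≡ o₀
      b≡o₀ = Nv-independent {G = G} {Y = A} A-independent (subst (_∈ A) a≡o₀ a∈A) b∈A
               (charged-to-neighbour {b} o₀∈Cb)

    wa≤wb : w a ≤ w b
    wa≤wb = charged-to-heaviest {b} o₀∈Cb (Nv-－⊆ {G = G} {Y = A} a∈N[o₀])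

    light-a : ∀ {o u} → o ∈ C a → u ∈ Nv G o (A － a) → w u ≤ (1ℚ - ε) * w a
    light-a {o} {u} o∈Ca u∈N = light-neighbour ε {a} a∈A o∈Ca u∈N no-arc
      where
      no-arc : ¬ Arc ε u a
      no-arc arc = a≢b (proj₂ (proj₂ isolated u a arc (inj₂ (inj₂ (inj₁ refl)))))

    light-b : ∀ {o u} → o ∈ C b → u ∈ (Nv G o (A － b) － a) → w u ≤ (1ℚ - ε) * w b
    light-b {o} {u} o∈Cb u∈N－a = light-neighbour ε {b} b∈A o∈Cb u∈N no-arc
      where
      u∈N : u ∈ Nv G o (A － b)
      u∈N = proj₁ (∈-－⁻ {X = Nv G o (A － b)} u∈N－a)
      no-arc : ¬ Arc ε u b
      no-arc arc = proj₂ (∈-－⁻ {X = Nv G o (A － b)} u∈N－a)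
                     (proj₁ (proj₂ isolated u b arc (inj₂ (inj₂ (inj₂ refl)))))

    exchange-ab : w²[ w ] (C a) + w²[ w ] (C b) + w a * w a ≤ w²[ w ] (N⁺ a) + w²[ w ] (N⁺ b)
    exchange-ab = begin
      w²[ w ] (C a) + w²[ w ] (C b) + w a * w a   ≡⟨ cong (_+ w a * w a) (Σ∈-∪-disjoint (C a) (C b) _ Ca∩Cb≡∅) ⟨
      w²[ w ] (C a ∪ C b) + w a * w a             ≤⟨ ℚ.+-mono-≤ (exchange-pair locally-optimal a∈A b∈A a≢b)
                                                         (Σ∈-term a∈N⁺a∩N⁺b (λ v _ → 0≤w² v)) ⟩
      w²[ w ] (N⁺ a ∪ N⁺ b) + w²[ w ] (N⁺ a ∩ N⁺ b) ≡⟨ Σ∈-∪-∩ (N⁺ a) (N⁺ b) _ ⟩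
      w²[ w ] (N⁺ a) + w²[ w ] (N⁺ b)             ∎
      where
      open ℚ.≤-Reasoning
      Ca∩Cb≡∅ : ∀ o → o ∈ C a → o ∈ C b → ⊥
      Ca∩Cb≡∅ o o∈Ca o∈Cb = a≢b (C-functional {a} {b} o∈Ca o∈Cb)
      a∈N⁺a∩N⁺b : a ∈ (N⁺ a ∩ N⁺ b)
      a∈N⁺a∩N⁺b = T-∧⁺ (c∈N⁺c a) a∈N⁺b

    Z : ℚ
    Z = Σ∈ (C b) (λ o → w²[ w ] (Nv G o (A － b) － a))

    U : VSet n
    U = ⋃ (C b) (λ o → Nv G o (A － b) － a)

    N⁺b-cover : N⁺ b ⊆ (｛ b ｝ ∪ (｛ a ｝ ∪ U))
    N⁺b-cover v v∈N⁺b with ∈-N⁺⁻ {b} v∈N⁺b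
    ... | inj₁ v≡b = ∈-∪⁺ˡ ｛ b ｝ (｛ a ｝ ∪ U) {v} (subst (_∈ ｛ b ｝) (≡-sym v≡b) (∈-｛｝⁺ b))
    ... | inj₂ (o , o∈Cb , v∈N) with T-∨⁻ (∈-｛｝∪－ {X = Nv G o (A － b)} {a} v∈N)
    ...   | inj₁ v∈｛a｝ = ∈-∪⁺ʳ ｛ b ｝ (｛ a ｝ ∪ U) {v} (∈-∪⁺ˡ ｛ a ｝ U {v} v∈｛a｝)
    ...   | inj₂ v∈N－a = ∈-∪⁺ʳ ｛ b ｝ (｛ a ｝ ∪ U) {v} (∈-∪⁺ʳ ｛ a ｝ U {v}
                              (∈-⋃⁺ {X = C b} {F = λ o → Nv G o (A － b) － a} o∈Cb v∈N－a))

    N⁺b-bound : w²[ w ] (N⁺ b) ≤ w b * w b + (w a * w a + Z)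
    N⁺b-bound = begin
      w²[ w ] (N⁺ b)                                 ≤⟨ Σ∈-⊆ N⁺b-cover (λ v _ → 0≤w² v) ⟩
      w²[ w ] (｛ b ｝ ∪ (｛ a ｝ ∪ U))                ≤⟨ Σ∈-∪ ｛ b ｝ (｛ a ｝ ∪ U) 0≤w² ⟩
      w²[ w ] ｛ b ｝ + w²[ w ] (｛ a ｝ ∪ U)          ≤⟨ ℚ.+-monoʳ-≤ (w²[ w ] ｛ b ｝) (Σ∈-∪ ｛ a ｝ U 0≤w²) ⟩
      w²[ w ] ｛ b ｝ + (w²[ w ] ｛ a ｝ + w²[ w ] U)  ≡⟨ cong₂ (λ s t → s + (t + w²[ w ] U)) (Σ∈-｛｝ b _) (Σ∈-｛｝ a _) ⟩
      w b * w b + (w a * w a + w²[ w ] U)            ≤⟨ ℚ.+-monoʳ-≤ (w b * w b) (ℚ.+-monoʳ-≤ (w a * w a)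
                                                          (Σ∈-⋃ (C b) (λ o → Nv G o (A － b) － a) 0≤w²)) ⟩
      w b * w b + (w a * w a + Z)                    ∎
      where open ℚ.≤-Reasoning

    ψa-bound : ∀ {o} → o ∈ C a → w a * (δ * w[ w ] (Nv G o A)) ≤ ψ a o + δ * (w a * w a)
    ψa-bound {o} o∈Ca = 0≤q-p⇒p≤q (subst (0ℚ ≤_) slack≡
      (+-nonNeg (square-nonNeg (w o - w a)) (p≤q⇒0≤q-p light)))
      where
      W W² : ℚ
      W = w[ w ] (Nv G o (A － a))
      W² = w²[ w ] (Nv G o (A － a))
      light : 1ℚ * W² ≤ (1ℚ - δ) * w a * W
      light = Σ∈-square-≤ (Nv G o (A － a)) w {(1ℚ - δ) * w a} {1ℚ} 0≤w (λ u u∈N →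
        subst (_≤ (1ℚ - δ) * w a) (≡-sym (ℚ.*-identityˡ (w u)))
          (ℚ.≤-trans (light-a o∈Ca u∈N) (ℚ.*-monoʳ-≤-nonNeg (w a) {{nonNegative (0≤w a)}} 1-ε≤1-δ)))
      slack≡ : (w o - w a) * (w o - w a) + ((1ℚ - δ) * w a * W - 1ℚ * W²)
               ≡ ψ a o + δ * (w a * w a) - w a * (δ * w[ w ] (Nv G o A))
      slack≡ = begin
        (w o - w a) * (w o - w a) + ((1ℚ - δ) * w a * W - 1ℚ * W²)
          ≡⟨ solve 5 (λ wo x δ W W² → (wo :- x) :* (wo :- x) :+ ((con 1ℚ :- δ) :* x :* W :- con 1ℚ :* W²)
                := ((wo :- x) :* (wo :- x) :+ x :* W :- W²) :+ δ :* (x :* x) :- x :* (δ :* (x :+ W)))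
               refl (w o) (w a) δ W W² ⟩
        ψ a o + δ * (w a * w a) - w a * (δ * (w a + W))
          ≡⟨ cong (λ t → ψ a o + δ * (w a * w a) - w a * (δ * t)) (w-N-split {a} o∈Ca) ⟨
        ψ a o + δ * (w a * w a) - w a * (δ * w[ w ] (Nv G o A)) ∎
        where open ≡-Reasoning

    ψb-bound : ∀ {o} → o ∈ C b →
      w b * (δ * w[ w ] (Nv G o A)) + (g - δ) * (w b * w b)
        + 𝟙 (Nv G o (A － b) a) * (w a * ((1ℚ - δ) * w b - w a)) + q * w²[ w ] (Nv G o (A － b) － a)
        ≤ ψ b o + q * (w o * w o)
    ψb-bound {o} o∈Cb = 0≤q-p⇒p≤q (subst (0ℚ ≤_) slack≡
      (+-nonNeg (p≤q⇒0≤q-p (square-bound (w o) (w b))) (p≤q⇒0≤q-p light)))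
      where
      N : VSet n
      N = Nv G o (A － b)
      I W W² : ℚ
      I = 𝟙 (N a)
      W = w[ w ] (N － a)
      W² = w²[ w ] (N － a)
      w-split : w[ w ] N ≡ I * w a + W
      w-split = trans (Σ∈-split N a w) (cong (_+ W) (if≡𝟙* (N a) (w a)))
      w²-split : w²[ w ] N ≡ I * (w a * w a) + W²
      w²-split = trans (Σ∈-split N a (λ v → w v * w v)) (cong (_+ W²) (if≡𝟙* (N a) (w a * w a)))
      light : (1ℚ + q) * W² ≤ (1ℚ - δ) * w b * W
      light = Σ∈-square-≤ (N － a) w {(1ℚ - δ) * w b} {1ℚ + q} 0≤w (λ u u∈N－a →
        ℚ.≤-trans (ℚ.*-monoˡ-≤-nonNeg (1ℚ + q) {{nonNegative (ℚ.<⇒≤ 0<1+q)}} (light-b o∈Cb u∈N－a))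
          (ℚ.≤-reflexive (trans (≡-sym (ℚ.*-assoc (1ℚ + q) (1ℚ - ε) (w b))) (cong (_* w b) [1+q][1-ε]≡1-δ))))
      slack≡ : ((w o - w b) * (w o - w b) + q * (w o * w o) - g * (w b * w b))
                 + ((1ℚ - δ) * w b * W - (1ℚ + q) * W²)
               ≡ ψ b o + q * (w o * w o)
                 - (w b * (δ * w[ w ] (Nv G o A)) + (g - δ) * (w b * w b)
                    + I * (w a * ((1ℚ - δ) * w b - w a)) + q * W²)
      slack≡ = begin
        ((w o - w b) * (w o - w b) + q * (w o * w o) - g * (w b * w b)) + ((1ℚ - δ) * w b * W - (1ℚ + q) * W²)
          ≡⟨ solve 9 (λ wo x y δ g q I W W² →
                 ((wo :- y) :* (wo :- y) :+ q :* (wo :* wo) :- g :* (y :* y)) :+ ((con 1ℚ :- δ) :* y :* W :- (con 1ℚ :+ q) :* W²)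
              := ((wo :- y) :* (wo :- y) :+ y :* (I :* x :+ W) :- (I :* (x :* x) :+ W²)) :+ q :* (wo :* wo)
                 :- (y :* (δ :* (y :+ (I :* x :+ W))) :+ (g :- δ) :* (y :* y)
                     :+ I :* (x :* ((con 1ℚ :- δ) :* y :- x)) :+ q :* W²))
               refl (w o) (w a) (w b) δ g q I W W² ⟩
        ((w o - w b) * (w o - w b) + w b * (I * w a + W) - (I * (w a * w a) + W²)) + q * (w o * w o)
          - (w b * (δ * (w b + (I * w a + W))) + (g - δ) * (w b * w b)
             + I * (w a * ((1ℚ - δ) * w b - w a)) + q * W²)
          ≡⟨ cong₂ (λ s t → ((w o - w b) * (w o - w b) + w b * s - t) + q * (w o * w o)
                      - (w b * (δ * (w b + s)) + (g - δ) * (w b * w b) + I * (w a * ((1ℚ - δ) * w b - w a)) + q * W²))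
                   w-split w²-split ⟨
        ψ b o + q * (w o * w o)
          - (w b * (δ * (w b + w[ w ] N)) + (g - δ) * (w b * w b) + I * (w a * ((1ℚ - δ) * w b - w a)) + q * W²)
          ≡⟨ cong (λ s → ψ b o + q * (w o * w o)
                      - (w b * (δ * s) + (g - δ) * (w b * w b) + I * (w a * ((1ℚ - δ) * w b - w a)) + q * W²))
                  (w-N-split {b} o∈Cb) ⟨
        ψ b o + q * (w o * w o)
          - (w b * (δ * w[ w ] (Nv G o A)) + (g - δ) * (w b * w b) + I * (w a * ((1ℚ - δ) * w b - w a)) + q * W²)
          ∎
        where open ≡-Reasoning

    T[_] : Fin n → ℚ
    T[ c ] = Σ∈ (C c) (λ o → δ * w[ w ] (Nv G o A))

    witnesses : VSet n
    witnesses = C b ∩ (λ o → Nv G o (A － b) a)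

    Ψa-bound : w a * T[ a ] ≤ Ψ a + δ * (w a * w a) * ℕ→ℚ (card (C a))
    Ψa-bound = begin
      w a * T[ a ]                                          ≡⟨ Σ∈-* (C a) (w a) _ ⟨
      Σ∈ (C a) (λ o → w a * (δ * w[ w ] (Nv G o A)))        ≤⟨ Σ∈-mono (C a) (λ o o∈Ca → ψa-bound o∈Ca) ⟩
      Σ∈ (C a) (λ o → ψ a o + δ * (w a * w a))              ≡⟨ Σ∈-+ (C a) (ψ a) _ ⟩
      Ψ a + Σ∈ (C a) (λ _ → δ * (w a * w a))                ≡⟨ cong (_+_ (Ψ a)) (Σ∈-const (C a) _) ⟩
      Ψ a + δ * (w a * w a) * ℕ→ℚ (card (C a))              ∎
      where open ℚ.≤-Reasoning

    Ψb-bound : w b * T[ b ] + (g - δ) * (w b * w b) * ℕ→ℚ (card (C b))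
                 + w a * ((1ℚ - δ) * w b - w a) * ℕ→ℚ (card witnesses) + q * Z
               ≤ Ψ b + q * w²[ w ] (C b)
    Ψb-bound = begin
      w b * T[ b ] + (g - δ) * (w b * w b) * ℕ→ℚ (card (C b)) + K * ℕ→ℚ (card witnesses) + q * Z
        ≡⟨ cong₂ (λ s t → s + t + K * ℕ→ℚ (card witnesses) + q * Z)
                 (Σ∈-* (C b) (w b) _) (Σ∈-const (C b) _) ⟨
      Σ∈ (C b) f₁ + Σ∈ (C b) f₂ + K * ℕ→ℚ (card witnesses) + q * Z
        ≡⟨ cong₂ (λ s t → Σ∈ (C b) f₁ + Σ∈ (C b) f₂ + s + t)
                 (Σ∈-𝟙 (C b) (λ o → Nv G o (A － b) a) K) (Σ∈-* (C b) q _) ⟨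
      Σ∈ (C b) f₁ + Σ∈ (C b) f₂ + Σ∈ (C b) f₃ + Σ∈ (C b) f₄
        ≡⟨ cong (λ s → s + Σ∈ (C b) f₃ + Σ∈ (C b) f₄) (Σ∈-+ (C b) f₁ f₂) ⟨
      Σ∈ (C b) (λ o → f₁ o + f₂ o) + Σ∈ (C b) f₃ + Σ∈ (C b) f₄
        ≡⟨ cong (_+ Σ∈ (C b) f₄) (Σ∈-+ (C b) (λ o → f₁ o + f₂ o) f₃) ⟨
      Σ∈ (C b) (λ o → f₁ o + f₂ o + f₃ o) + Σ∈ (C b) f₄
        ≡⟨ Σ∈-+ (C b) (λ o → f₁ o + f₂ o + f₃ o) f₄ ⟨
      Σ∈ (C b) (λ o → f₁ o + f₂ o + f₃ o + f₄ o)
        ≤⟨ Σ∈-mono (C b) (λ o o∈Cb → ψb-bound o∈Cb) ⟩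
      Σ∈ (C b) (λ o → ψ b o + q * (w o * w o))
        ≡⟨ trans (Σ∈-+ (C b) (ψ b) _) (cong (_+_ (Ψ b)) (Σ∈-* (C b) q _)) ⟩
      Ψ b + q * w²[ w ] (C b)
        ∎
      where
      open ℚ.≤-Reasoning
      K : ℚ
      K = w a * ((1ℚ - δ) * w b - w a)
      f₁ f₂ f₃ f₄ : Fin n → ℚ
      f₁ o = w b * (δ * w[ w ] (Nv G o A))
      f₂ o = (g - δ) * (w b * w b)
      f₃ o = 𝟙 (Nv G o (A － b) a) * K
      f₄ o = q * w²[ w ] (Nv G o (A － b) － a)

    O-neighbours-of-a : VSet n
    O-neighbours-of-a o = O o ∧ adj G a o

    adjacent-to-a : ∀ {o} (Y : VSet n) → o ∈ O → a ∈ Nv G o Y → o ∈ O-neighbours-of-a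
    adjacent-to-a {o} Y o∈O a∈N with proj₂ (∈-Nv⁻ {G = G} {Y = Y} a∈N)
    ... | inj₁ adj-o-a = T-∧⁺ o∈O (Equivalence.from T-≡ (trans (symm G a o) adj-o-a))
    ... | inj₂ a≡o = ⊥-elim (a∉O (subst (_∈ O) (≡-sym a≡o) o∈O))

    charged-count : ℕ→ℚ (card (C a)) + ℕ→ℚ (card witnesses) ≤ ℕ→ℚ k
    charged-count = begin
      ℕ→ℚ (card (C a)) + ℕ→ℚ (card witnesses)        ≡⟨ cong₂ _+_ (card≡Σ∈ (C a)) (card≡Σ∈ witnesses) ⟩
      Σ∈ (C a) (λ _ → 1ℚ) + Σ∈ witnesses (λ _ → 1ℚ)  ≡⟨ Σ∈-∪-disjoint (C a) witnesses _ Ca∩witnesses≡∅ ⟨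
      Σ∈ (C a ∪ witnesses) (λ _ → 1ℚ)                 ≤⟨ Σ∈-⊆ charged⊆O-neighbours (λ _ _ → ℚ.nonNegative⁻¹ 1ℚ) ⟩
      Σ∈ O-neighbours-of-a (λ _ → 1ℚ)                 ≡⟨ card≡Σ∈ O-neighbours-of-a ⟨
      ℕ→ℚ (card O-neighbours-of-a)                    ≤⟨ ℕ→ℚ-mono few-O-neighbours ⟩
      ℕ→ℚ k                                           ∎
      where
      open ℚ.≤-Reasoning
      few-O-neighbours : card O-neighbours-of-a ℕ.≤ k
      few-O-neighbours = independent-neighbours-≤ {G = G} claw-free a O-neighbours-of-a
        (λ v v∈N → Equivalence.to T-≡ (proj₂ (T-∧⁻ {O v} v∈N)))
        (λ u v u∈N v∈N → O-independent u v (proj₁ (T-∧⁻ {O u} u∈N)) (proj₁ (T-∧⁻ {O v} v∈N)))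
      Ca∩witnesses≡∅ : ∀ o → o ∈ C a → o ∈ witnesses → ⊥
      Ca∩witnesses≡∅ o o∈Ca o∈W = a≢b (C-functional {a} {b} o∈Ca (proj₁ (T-∧⁻ {C b o} o∈W)))
      charged⊆O-neighbours : (C a ∪ witnesses) ⊆ O-neighbours-of-a
      charged⊆O-neighbours o o∈ with T-∨⁻ {C a o} o∈
      ... | inj₁ o∈Ca = adjacent-to-a A (proj₁ (∈-C⁻ {a} o∈Ca)) (charged-to-neighbour {a} o∈Ca)
      ... | inj₂ o∈W = let o∈Cb , a∈N = T-∧⁻ {C b o} o∈W in
        adjacent-to-a (A － b) (proj₁ (∈-C⁻ {b} o∈Cb)) a∈N

    1≤|witnesses| : 1ℚ ≤ ℕ→ℚ (card witnesses)
    1≤|witnesses| = subst (1ℚ ≤_) (≡-sym (card≡Σ∈ witnesses))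
      (Σ∈-term {X = witnesses} (T-∧⁺ o₀∈Cb a∈N[o₀]) (λ _ _ → ℚ.nonNegative⁻¹ 1ℚ))

    isolated-edge-bound : ((1ℚ - q) - ℕ→ℚ k * δ) * w a
              + (ℕ→ℚ (card (C b)) * g - q - ℕ→ℚ (card (C b)) * δ) * w b + (T[ a ] + T[ b ])
            ≤ (Δ a /ℚ w a + Ψ a /ℚ w a) + (Δ b /ℚ w b + Ψ b /ℚ w b)
    isolated-edge-bound = combine-bounds {g = g} {cb = ℕ→ℚ (card (C b))} (w>0 a) wa≤wb 0≤δ 0≤q
      (exchange-single locally-optimal a∈A) (exchange-single locally-optimal b∈A) exchange-ab N⁺b-bound
      Ψa-bound Ψb-bound charged-count 1≤|witnesses|

lemma8 : ∀ {n} (k : ℕ) → 1 ℕ.≤ k →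
  (G : Graph n) → ClawFree (suc k) G →
  (w : Weight n) → (∀ v → 0ℚ < w v) →
  (O A : VSet n) → MaxWeightIndependent G w O → Independent G A →
  (∀ o → o ∈ O → Σ (Fin n) λ a → a ∈ Nv G o A) →
  (π : Fin n → Fin n) →
  (∀ o → o ∈ O → π o ∈ Nv G o A × (∀ a → a ∈ Nv G o A → w a ≤ w (π o))) →
  Setup.LocallyOptimal G w O A π 2 →
  (δ ε : ℚ) → 0ℚ ≤ δ → δ ≤ ε → ε ≤ (+ 1) / 2 →
  (a b : Fin n) → Setup.IsolatedEdge G w O A π ε a b →
  let open Setup G w O A π
      ρ : ℕ → ℚ
      ρ t = (ℕ→ℚ t * (ε - δ)) /ℚ (1ℚ - δ) - (ε - δ) /ℚ (1ℚ - ε)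
      cb = card (C b)
  in ((1ℚ - (ε - δ) /ℚ (1ℚ - ε)) - ℕ→ℚ k * δ) * w a
     + (ρ cb - ℕ→ℚ cb * δ) * w b
     + (Σ∈ (C a) (λ o → δ * w[ w ] (Nv G o A))
        + Σ∈ (C b) (λ o → δ * w[ w ] (Nv G o A)))
     ≤ (Δ a /ℚ w a + Ψ a /ℚ w a) + (Δ b /ℚ w b + Ψ b /ℚ w b)
lemma8 k _ G claw-free w w>0 O A max-O A-independent _ π π-heaviest locally-optimal
       δ ε 0≤δ δ≤ε ε≤½ a b isolated =
  subst (_≤ _) ρ-unfolded isolated-edge-bound
  where
  ε<1 : ε < 1ℚ
  ε<1 = ℚ.≤-<-trans ε≤½ (toWitness {a? = (+ 1) / 2 ℚ.<? 1ℚ} tt)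
  open Setup G w O A π using (C)
  open Parameters δ ε δ≤ε ε<1
  open Charging G w O A π π-heaviest
  open IsolatedEdgeBounds claw-free w>0 (proj₁ max-O) A-independent locally-optimal δ ε 0≤δ δ≤ε ε<1 isolated
  cb : ℚ
  cb = ℕ→ℚ (card (C b))
  ρ-unfolded : ((1ℚ - q) - ℕ→ℚ k * δ) * w a + (cb * g - q - cb * δ) * w b + (T[ a ] + T[ b ])
             ≡ ((1ℚ - q) - ℕ→ℚ k * δ) * w a + ((cb * (ε - δ)) /ℚ (1ℚ - δ) - q - cb * δ) * w b + (T[ a ] + T[ b ])
  ρ-unfolded = cong (λ r → ((1ℚ - q) - ℕ→ℚ k * δ) * w a + (r - q - cb * δ) * w b + (T[ a ] + T[ b ]))
                    (≡-sym (*-/ℚ-assoc cb (ε - δ) (1ℚ - δ)))
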